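{- There exist an integer $n$ and fuzzy posets $\mathbb{X}_1=\langle X_1;\mu_{X_1}\rangle,\dots,\mathbb{X}_n=\langle X_n;\mu_{X_n}\rangle$ such that $\langle\prod_{i=1}^n X_i;\mu_p\rangle$ is not a fuzzy poset, where $\mu_p((x_1,\dots,x_n),(y_1,\dots,y_n))=\max\left(\sum_{i=1}^n\mu_{X_i}(x_i,y_i)-(n-1),\,0\right)$ (the direct Łukasiewicz product).
   Context: A fuzzy relation on a set $X$ is a map $\mu\colon X\times X\to[0,1]$; it is reflexive if $\mu(x,x)=1$; transitive if $\mu(x,y)>0$ and $\mu(y,z)>0$ imply $\mu(x,z)>0$; anti-symmetric if $\mu(x,y)>0$ and $\mu(y,x)>0$ imply $x=y$. A fuzzy poset is $\langle X;\mu\rangle$ with $\mu$ reflexive, transitive and anti-symmetric. -}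

module Defs where

open import Data.Nat using (ℕ; zero; suc)
open import Data.Fin using (Fin; zero; suc)
open import Data.Integer using (+_)
open import Data.Rational using (ℚ; 0ℚ; 1ℚ; _+_; _-_; _⊔_; _≤_; _<_; _/_)
open import Data.Product using (_×_)
open import Relation.Binary.PropositionalEquality using (_≡_)

IsFuzzyRelation : {X : Set} → (X → X → ℚ) → Set
IsFuzzyRelation {X} μ = ∀ (x y : X) → (0ℚ ≤ μ x y) × (μ x y ≤ 1ℚ)

Reflexive : {X : Set} → (X → X → ℚ) → Set
Reflexive {X} μ = ∀ (x : X) → μ x x ≡ 1ℚ

Transitive : {X : Set} → (X → X → ℚ) → Set
Transitive {X} μ = ∀ (x y z : X) → 0ℚ < μ x y → 0ℚ < μ y z → 0ℚ < μ x z

AntiSymmetric : {X : Set} → (X → X → ℚ) → Set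
AntiSymmetric {X} μ = ∀ (x y : X) → 0ℚ < μ x y → 0ℚ < μ y x → x ≡ y

IsFuzzyPoset : {X : Set} → (X → X → ℚ) → Set
IsFuzzyPoset μ = IsFuzzyRelation μ × Reflexive μ × Transitive μ × AntiSymmetric μ

sumFin : (n : ℕ) → (Fin n → ℚ) → ℚ
sumFin zero    f = 0ℚ
sumFin (suc n) f = f zero + sumFin n (λ i → f (suc i))

ℕtoℚ : ℕ → ℚ
ℕtoℚ n = (+ n) / 1

μLuk : (n : ℕ) (X : Fin n → Set) (μ : (i : Fin n) → X i → X i → ℚ)
     → ((i : Fin n) → X i) → ((i : Fin n) → X i) → ℚ
μLuk n X μ x y = (sumFin n (λ i → μ i (x i) (y i)) - (ℕtoℚ n - 1ℚ)) ⊔ 0ℚ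

-- Take the two-element chain false < true with μ(false, true) = ½. In the
-- Łukasiewicz square, (false,false) → (true,false) → (true,true) are steps of
-- degree ½ + 1 − 1 = ½, but the composite has degree max(½ + ½ − 1, 0) = 0,
-- so the product relation is not transitive.
module Submission where

open import Defs
open import Data.Nat using (ℕ)
open import Data.Fin using (Fin; zero; suc)
open import Data.Rational using (ℚ; 0ℚ; 1ℚ; ½; _≤?_; _<?_; _<_)
open import Data.Rational.Properties using (<-irrefl)
open import Data.Bool using (Bool; true; false; f≤t; b≤b) renaming (_≤_ to _≤ᵇ_)
import Data.Bool.Properties as Bool
open import Data.Product using (Σ; _×_; _,_)
open import Data.Empty using (⊥-elim)
open import Relation.Nullary using (¬_)
open import Relation.Nullary.Decidable using (toWitness)
open import Relation.Binary.PropositionalEquality using (refl)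

μ-chain : Bool → Bool → ℚ
μ-chain false false = 1ℚ
μ-chain true  true  = 1ℚ
μ-chain false true  = ½
μ-chain true  false = 0ℚ

μ-chain-positive⇒≤ : ∀ {x y} → 0ℚ < μ-chain x y → x ≤ᵇ y
μ-chain-positive⇒≤ {false} {false} _ = b≤b
μ-chain-positive⇒≤ {true}  {true}  _ = b≤b
μ-chain-positive⇒≤ {false} {true}  _ = f≤t
μ-chain-positive⇒≤ {true}  {false} 0<0 = ⊥-elim (<-irrefl refl 0<0)

μ-chain-≤⇒positive : ∀ {x y} → x ≤ᵇ y → 0ℚ < μ-chain x y
μ-chain-≤⇒positive (f≤t)         = toWitness {a? = 0ℚ <? ½} _
μ-chain-≤⇒positive (b≤b {false}) = toWitness {a? = 0ℚ <? 1ℚ} _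
μ-chain-≤⇒positive (b≤b {true})  = toWitness {a? = 0ℚ <? 1ℚ} _

μ-chain-isFuzzyRelation : IsFuzzyRelation μ-chain
μ-chain-isFuzzyRelation false false = toWitness {a? = 0ℚ ≤? 1ℚ} _ , toWitness {a? = 1ℚ ≤? 1ℚ} _
μ-chain-isFuzzyRelation true  true  = toWitness {a? = 0ℚ ≤? 1ℚ} _ , toWitness {a? = 1ℚ ≤? 1ℚ} _
μ-chain-isFuzzyRelation false true  = toWitness {a? = 0ℚ ≤? ½}  _ , toWitness {a? = ½ ≤? 1ℚ}  _
μ-chain-isFuzzyRelation true  false = toWitness {a? = 0ℚ ≤? 0ℚ} _ , toWitness {a? = 0ℚ ≤? 1ℚ} _

μ-chain-reflexive : Reflexive μ-chain
μ-chain-reflexive false = refl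
μ-chain-reflexive true  = refl

μ-chain-transitive : Transitive μ-chain
μ-chain-transitive x y z xy yz =
  μ-chain-≤⇒positive (Bool.≤-trans (μ-chain-positive⇒≤ {x} {y} xy) (μ-chain-positive⇒≤ yz))

μ-chain-antiSymmetric : AntiSymmetric μ-chain
μ-chain-antiSymmetric x y xy yx =
  Bool.≤-antisym (μ-chain-positive⇒≤ {x} {y} xy) (μ-chain-positive⇒≤ yx)

μ-chain-isFuzzyPoset : IsFuzzyPoset μ-chain
μ-chain-isFuzzyPoset =
  μ-chain-isFuzzyRelation , μ-chain-reflexive , μ-chain-transitive , μ-chain-antiSymmetric

pair : Bool → Bool → (i : Fin 2) → Bool
pair a b zero    = a
pair a b (suc _) = b

μ-chain² : ((i : Fin 2) → Bool) → ((i : Fin 2) → Bool) → ℚ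
μ-chain² = μLuk 2 (λ _ → Bool) (λ _ → μ-chain)

μ-chain²-not-transitive : ¬ Transitive μ-chain²
μ-chain²-not-transitive trans = <-irrefl refl 0<0
  where
  0<0 : 0ℚ < μ-chain² (pair false false) (pair true true)
  0<0 = trans (pair false false) (pair true false) (pair true true)
          (toWitness {a? = 0ℚ <? μ-chain² (pair false false) (pair true false)} _)
          (toWitness {a? = 0ℚ <? μ-chain² (pair true false) (pair true true)} _)

theorem4p4 : Σ ℕ (λ n → Σ (Fin n → Set) (λ X → Σ ((i : Fin n) → X i → X i → ℚ) (λ μ →
               ((i : Fin n) → IsFuzzyPoset (μ i)) × ¬ IsFuzzyPoset (μLuk n X μ))))
theorem4p4 =
  2 , (λ _ → Bool) , (λ _ → μ-chain) , (λ _ → μ-chain-isFuzzyPoset) ,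
  λ (_ , _ , transitive , _) → μ-chain²-not-transitive transitive
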